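{- If $G$ is a finite simple graph of order $n$ with minimum degree $\delta(G)\ge 1$, then $2\le DC(G)\le n$.
   Context: Let $G=(V,E)$ be a finite simple undirected graph, $N[v]=\{v\}\cup N(v)$. A set $D\subseteq V$ is a double dominating set if $|N[v]\cap D|\ge 2$ for every $v\in V$. Two disjoint sets $V_1,V_2\subseteq V$ form a double coalition if neither is a double dominating set but $V_1\cup V_2$ is. A double coalition partition ($dc$-partition) of $G$ is a partition $\Pi$ of $V$ such that every set of $\Pi$ is not a double dominating set and forms a double coalition with some other set of $\Pi$. The double coalition number $DC(G)$ is the maximum cardinality of a $dc$-partition of $G$. -}

module Defs where

open import Data.Nat using (ℕ; _≤_)
open import Data.Bool using (Bool; true; false; _∨_)
open import Data.Fin using (Fin; _≟_)
open import Data.Fin.Subset using (Subset; ∣_∣; _∩_; _∪_)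
open import Data.Vec using (tabulate)
open import Data.Product using (Σ; _×_; ∃)
open import Function.Definitions using (Surjective)
open import Relation.Binary.PropositionalEquality using (_≡_)
open import Relation.Nullary using (¬_)
open import Relation.Nullary.Decidable using (⌊_⌋)

record Graph (n : ℕ) : Set where
  field
    adj     : Fin n → Fin n → Bool
    symm    : ∀ u v → adj u v ≡ adj v u
    irrefl  : ∀ v → adj v v ≡ false

open Graph public

MinDegreeAtLeast1 : ∀ {n} → Graph n → Set
MinDegreeAtLeast1 G = ∀ v → ∃ λ u → adj G v u ≡ true

closedNbhd : ∀ {n} → Graph n → Fin n → Subset n
closedNbhd G v = tabulate (λ u → ⌊ u ≟ v ⌋ ∨ adj G v u)

IsDoubleDominating : ∀ {n} → Graph n → Subset n → Set
IsDoubleDominating G D = ∀ v → 2 ≤ ∣ closedNbhd G v ∩ D ∣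

IsDoubleCoalition : ∀ {n} → Graph n → Subset n → Subset n → Set
IsDoubleCoalition G V₁ V₂ =
  ¬ IsDoubleDominating G V₁ × ¬ IsDoubleDominating G V₂ × IsDoubleDominating G (V₁ ∪ V₂)

-- A partition of Fin n into k (nonempty) classes, given by a surjective
-- class-assignment map f : Fin n → Fin k; class i is f⁻¹(i).
classOf : ∀ {n k} → (Fin n → Fin k) → Fin k → Subset n
classOf f i = tabulate (λ u → ⌊ f u ≟ i ⌋)

IsDCPartition : ∀ {n k} → Graph n → (Fin n → Fin k) → Set
IsDCPartition {n} {k} G f =
  Surjective _≡_ _≡_ f ×
  (∀ i → ¬ IsDoubleDominating G (classOf f i) ×
         ∃ λ j → ¬ (j ≡ i) × IsDoubleCoalition G (classOf f i) (classOf f j))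

HasDCPartitionOfSize : ∀ {n} → Graph n → ℕ → Set
HasDCPartitionOfSize {n} G k = Σ (Fin n → Fin k) λ f → IsDCPartition G f

IsDCNumber : ∀ {n} → Graph n → ℕ → Set
IsDCNumber G d = HasDCPartitionOfSize G d × (∀ k → HasDCPartitionOfSize G k → k ≤ d)

-- Singletons are never double dominating, so V can be split into n parts none of
-- which is double dominating; V itself is double dominating because δ(G) ≥ 1.
-- Take such a split with the fewest parts k ≥ 2.  Any two of its parts have a
-- double dominating union, for otherwise merging them would give a smaller split;
-- in particular no part is empty.  So it is a dc-partition.  A dc-partition has at
-- most n classes and all notions involved are decidable, so a largest one exists.
module Submission where

open import Data.Bool using (Bool; true; _∨_)
open import Data.Bool.Properties using (T-≡; ∨-zeroʳ)
open import Data.Empty using (⊥-elim)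
open import Data.Fin using (Fin; zero; suc; _≟_; punchIn; punchOut)
open import Data.Fin.Properties using (any?; all?; punchIn-punchOut; punchInᵢ≢i; injective⇒≤)
open import Data.Fin.Subset using (Subset; _∈_; _⊆_; _∩_; _∪_; ∣_∣; ⁅_⁆; ⊤)
open import Data.Fin.Subset.Properties
  using (x∈p∩q⁺; x∈p∩q⁻; x∈p∪q⁻; x∈p∪q⁺; ∈⊤; x∈⁅x⁆; ∣⁅x⁆∣≡1; ∣p∩q∣≤∣q∣;
         p⊆q⇒∣p∣≤∣q∣; x∈p⇒∣p-x∣<∣p∣; x∈p∧x≢y⇒x∈p-y)
open import Data.Nat using (ℕ; zero; suc; _≤_; _<_; z≤n; s≤s; _≤?_)
open import Data.Nat.Induction using (<-rec)
open import Data.Nat.Properties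
  using (≤-trans; ≤-reflexive; ≤-<-trans; ≤∧≢⇒<; m<1+n⇒m≤n; n<1+n; 1+n≰n; anyUpTo?)
open import Data.Product using (Σ; ∃; _×_; _,_)
open import Data.Sum using (_⊎_; inj₁; inj₂)
open import Data.Vec using (tabulate)
open import Data.Vec.Properties using (lookup∘tabulate; tabulate-cong; []=⇒lookup; lookup⇒[]=)
open import Data.Vec.Functional using (_∷_)
open import Function using (_∘_; id)
open import Function.Bundles using (Equivalence)
open import Function.Definitions using (Surjective)
open import Level using (Level)
open import Relation.Binary.PropositionalEquality
  using (_≡_; _≢_; _≗_; refl; sym; trans; cong; subst; subst₂)
open import Relation.Nullary using (¬_; Dec; yes; no; contradiction)
open import Relation.Nullary.Decidable
  using (⌊_⌋; toWitness; fromWitness; map′; _×-dec_; ¬?; decidable-stable)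
open import Relation.Unary using (Pred; Decidable)

open import Defs

private
  variable
    p : Level
    k m n : ℕ

IsLeast : Pred ℕ p → Pred ℕ p
IsLeast P k = P k × (∀ {j} → j < k → ¬ P j)

IsGreatest : Pred ℕ p → Pred ℕ p
IsGreatest P d = P d × (∀ k → P k → k ≤ d)

module _ {P : Pred ℕ p} (P? : Decidable P) where

  least : P n → ∃ (IsLeast P)
  least {n} = <-rec (λ n → P n → ∃ (IsLeast P)) search n
    where
    search : ∀ n → (∀ {m} → m < n → P m → ∃ (IsLeast P)) → P n → ∃ (IsLeast P)
    search n below pn with anyUpTo? P? n
    ... | yes (m , m<n , pm) = below m<n pm
    ... | no ∄m              = n , pn , λ j<n pj → ∄m (_ , j<n , pj)

  greatest : ∀ b → (∀ {k} → P k → k ≤ b) → P m → ∃ (IsGreatest P)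
  greatest zero    bounded pm = _ , pm , λ _ pk → ≤-trans (bounded pk) z≤n
  greatest (suc b) bounded pm with P? (suc b)
  ... | yes pb = suc b , pb , λ _ → bounded
  ... | no ¬pb = greatest b (λ pk → m<1+n⇒m≤n (≤∧≢⇒< (bounded pk) λ { refl → ¬pb pk })) pm

any-function? : ∀ n {P : Pred (Fin n → Fin k) p} →
                (∀ {f g} → f ≗ g → P f → P g) → Decidable P → Dec (∃ P)
any-function? zero    P-cong P? = map′ (λ pf → _ , pf) (λ (f , pf) → P-cong (λ ()) pf) (P? (λ ()))
any-function? (suc n) P-cong P? =
  map′ (λ (a , g , pf) → a ∷ g , pf)
       (λ (f , pf) → f zero , f ∘ suc , P-cong (λ { zero → refl ; (suc _) → refl }) pf)
       (any? λ a → any-function? n (λ f≗g → P-cong λ { zero → refl ; (suc x) → f≗g x })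
                                   (λ g → P? (a ∷ g)))

surjective⇒≤ : {f : Fin n → Fin k} → Surjective _≡_ _≡_ f → k ≤ n
surjective⇒≤ {f = f} surj = injective⇒≤ section-injective
  where
  section : Fin _ → Fin _
  section y = let (x , _) = surj y in x

  f∘section : ∀ y → f (section y) ≡ y
  f∘section y = let (_ , fx≡y) = surj y in fx≡y refl

  section-injective : ∀ {x y} → section x ≡ section y → x ≡ y
  section-injective {x} {y} eq = trans (sym (f∘section x)) (trans (cong f eq) (f∘section y))

surjective? : (f : Fin n → Fin k) → Dec (Surjective _≡_ _≡_ f)
surjective? f = map′ hit⇒surjective surjective⇒hit (all? λ y → any? λ x → f x ≟ y)
  where
  hit⇒surjective : (∀ y → ∃ λ x → f x ≡ y) → Surjective _≡_ _≡_ f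
  hit⇒surjective hit y = let (x , fx≡y) = hit y in x , λ { refl → fx≡y }

  surjective⇒hit : Surjective _≡_ _≡_ f → ∀ y → ∃ λ x → f x ≡ y
  surjective⇒hit surj y = let (x , fx≡y) = surj y in x , fx≡y refl

module _ {A : Set} (a? : Dec A) where

  ⌊⌋≡true⁺ : A → ⌊ a? ⌋ ≡ true
  ⌊⌋≡true⁺ a = Equivalence.to T-≡ (fromWitness a)

  ⌊⌋≡true⁻ : ⌊ a? ⌋ ≡ true → A
  ⌊⌋≡true⁻ eq = toWitness (Equivalence.from T-≡ eq)

module _ {h : Fin n → Bool} {x : Fin n} where

  ∈-tabulate⁺ : h x ≡ true → x ∈ tabulate h
  ∈-tabulate⁺ hx = lookup⇒[]= x (tabulate h) (trans (lookup∘tabulate h x) hx)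

  ∈-tabulate⁻ : x ∈ tabulate h → h x ≡ true
  ∈-tabulate⁻ x∈ = trans (sym (lookup∘tabulate h x)) ([]=⇒lookup x∈)

module _ {f : Fin n → Fin k} {i : Fin k} {x : Fin n} where

  ∈-classOf⁺ : f x ≡ i → x ∈ classOf f i
  ∈-classOf⁺ = ∈-tabulate⁺ ∘ ⌊⌋≡true⁺ (f x ≟ i)

  ∈-classOf⁻ : x ∈ classOf f i → f x ≡ i
  ∈-classOf⁻ = ⌊⌋≡true⁻ (f x ≟ i) ∘ ∈-tabulate⁻

classOf-cong : {f g : Fin n → Fin k} → f ≗ g → ∀ i → classOf f i ≡ classOf g i
classOf-cong f≗g i = tabulate-cong λ x → cong (λ y → ⌊ y ≟ i ⌋) (f≗g x)

distinct∈⇒2≤∣p∣ : {p : Subset n} {x y : Fin n} → x ∈ p → y ∈ p → x ≢ y → 2 ≤ ∣ p ∣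
distinct∈⇒2≤∣p∣ x∈p y∈p x≢y =
  ≤-<-trans (≤-<-trans z≤n (x∈p⇒∣p-x∣<∣p∣ (x∈p∧x≢y⇒x∈p-y y∈p (x≢y ∘ sym))))
            (x∈p⇒∣p-x∣<∣p∣ x∈p)

module _ (G : Graph n) where

  x∈N[x] : ∀ x → x ∈ closedNbhd G x
  x∈N[x] x = ∈-tabulate⁺ (cong (_∨ adj G x x) (⌊⌋≡true⁺ (x ≟ x) refl))

  adj⇒∈N[x] : ∀ {x y} → adj G x y ≡ true → y ∈ closedNbhd G x
  adj⇒∈N[x] {x} {y} xy = ∈-tabulate⁺ (trans (cong (⌊ y ≟ x ⌋ ∨_) xy) (∨-zeroʳ _))

  doubleDominating-mono : ∀ {D E} → D ⊆ E → IsDoubleDominating G D → IsDoubleDominating G E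
  doubleDominating-mono D⊆E dd v = ≤-trans (dd v) (p⊆q⇒∣p∣≤∣q∣ N∩D⊆N∩E)
    where
    N∩D⊆N∩E : closedNbhd G v ∩ _ ⊆ closedNbhd G v ∩ _
    N∩D⊆N∩E x∈ = let (x∈N , x∈D) = x∈p∩q⁻ _ _ x∈ in x∈p∩q⁺ (x∈N , D⊆E x∈D)

  ⁅⁆-notDoubleDominating : ∀ c → ¬ IsDoubleDominating G ⁅ c ⁆
  ⁅⁆-notDoubleDominating c dd =
    1+n≰n (≤-trans (dd c) (≤-trans (∣p∩q∣≤∣q∣ (closedNbhd G c) ⁅ c ⁆) (≤-reflexive (∣⁅x⁆∣≡1 c))))

  ⊤-doubleDominating : MinDegreeAtLeast1 G → IsDoubleDominating G ⊤
  ⊤-doubleDominating δ v =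
    let (u , vu) = δ v in
    distinct∈⇒2≤∣p∣ (x∈p∩q⁺ (x∈N[x] v , ∈⊤)) (x∈p∩q⁺ (adj⇒∈N[x] vu , ∈⊤)) (adj⇒≢ vu)
    where
    adj⇒≢ : ∀ {x y} → adj G x y ≡ true → x ≢ y
    adj⇒≢ {x} xy refl = contradiction (trans (sym xy) (irrefl G x)) λ ()

  doubleDominating? : Decidable (IsDoubleDominating G)
  doubleDominating? D = all? λ v → 2 ≤? ∣ closedNbhd G v ∩ D ∣

module _ (G : Graph n) where

  NonDominatingColouring : (Fin n → Fin k) → Set
  NonDominatingColouring f = ∀ i → ¬ IsDoubleDominating G (classOf f i)

  HasNonDominatingColouring : ℕ → Set
  HasNonDominatingColouring k = ∃ (NonDominatingColouring {k})

  nonDominatingColouring-cong : {f g : Fin n → Fin k} → f ≗ g →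
                                NonDominatingColouring f → NonDominatingColouring g
  nonDominatingColouring-cong f≗g nd i = nd i ∘ subst (IsDoubleDominating G) (sym (classOf-cong f≗g i))

  hasNonDominatingColouring? : Decidable HasNonDominatingColouring
  hasNonDominatingColouring? k =
    any-function? n nonDominatingColouring-cong λ f → all? λ i → ¬? (doubleDominating? G (classOf f i))

  id-nonDominating : NonDominatingColouring id
  id-nonDominating c = ⁅⁆-notDoubleDominating G c ∘ doubleDominating-mono G class⊆⁅c⁆
    where
    class⊆⁅c⁆ : classOf id c ⊆ ⁅ c ⁆
    class⊆⁅c⁆ x∈ = subst (_∈ ⁅ c ⁆) (sym (∈-classOf⁻ x∈)) (x∈⁅x⁆ c)

  nonDominating⇒2≤ : Fin n → MinDegreeAtLeast1 G →
                     (f : Fin n → Fin k) → NonDominatingColouring f → 2 ≤ k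
  nonDominating⇒2≤ {zero}            v δ f nd with () ← f v
  nonDominating⇒2≤ {suc zero}        v δ f nd =
    ⊥-elim (nd zero (doubleDominating-mono G (λ {x} _ → ∈-classOf⁺ (Fin1-zero (f x))) (⊤-doubleDominating G δ)))
    where
    Fin1-zero : (a : Fin 1) → a ≡ zero
    Fin1-zero zero = refl
  nonDominating⇒2≤ {suc (suc _)} v δ f nd = s≤s (s≤s z≤n)

module _ {i j : Fin (suc m)} (i≢j : i ≢ j) where

  merge : Fin (suc m) → Fin m
  merge a with a ≟ j
  ... | yes _   = punchOut (i≢j ∘ sym)
  ... | no a≢j  = punchOut (a≢j ∘ sym)

  merge-fibre : ∀ {a c} → merge a ≡ c → a ≡ punchIn j c ⊎ (a ≡ j × i ≡ punchIn j c)
  merge-fibre {a} refl with a ≟ j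
  ... | yes a≡j = inj₂ (a≡j , sym (punchIn-punchOut _))
  ... | no _    = inj₁ (sym (punchIn-punchOut _))

  module _ (f : Fin n → Fin (suc m)) {c : Fin m} where

    classOf-merge-⊆-∪ : punchIn j c ≡ i → classOf (merge ∘ f) c ⊆ classOf f i ∪ classOf f j
    classOf-merge-⊆-∪ j↑c≡i x∈ with merge-fibre (∈-classOf⁻ x∈)
    ... | inj₁ fx≡j↑c      = x∈p∪q⁺ (inj₁ (∈-classOf⁺ (trans fx≡j↑c j↑c≡i)))
    ... | inj₂ (fx≡j , _)  = x∈p∪q⁺ (inj₂ (∈-classOf⁺ fx≡j))

    classOf-merge-⊆ : punchIn j c ≢ i → classOf (merge ∘ f) c ⊆ classOf f (punchIn j c)
    classOf-merge-⊆ j↑c≢i x∈ with merge-fibre (∈-classOf⁻ x∈)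
    ... | inj₁ fx≡j↑c         = ∈-classOf⁺ fx≡j↑c
    ... | inj₂ (_ , i≡j↑c)    = contradiction (sym i≡j↑c) j↑c≢i

module _ {G : Graph n} {f : Fin n → Fin (suc (suc m))}
         (nd : NonDominatingColouring G f)
         (fewest : ∀ {k} → k < suc (suc m) → ¬ HasNonDominatingColouring G k) where

  union-doubleDominating : ∀ {i j} → i ≢ j → IsDoubleDominating G (classOf f i ∪ classOf f j)
  union-doubleDominating {i} {j} i≢j =
    decidable-stable (doubleDominating? G _) λ ¬dd → fewest (n<1+n _) (merge i≢j ∘ f , merged ¬dd)
    where
    merged : ¬ IsDoubleDominating G (classOf f i ∪ classOf f j) → NonDominatingColouring G (merge i≢j ∘ f)
    merged ¬dd c with punchIn j c ≟ i
    ... | yes j↑c≡i = ¬dd ∘ doubleDominating-mono G (classOf-merge-⊆-∪ i≢j f j↑c≡i)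
    ... | no  j↑c≢i = nd _ ∘ doubleDominating-mono G (classOf-merge-⊆ i≢j f j↑c≢i)

  fewest-surjective : Surjective _≡_ _≡_ f
  fewest-surjective y with any? (λ x → f x ≟ y)
  ... | yes (x , fx≡y) = x , λ { refl → fx≡y }
  ... | no ∄x = ⊥-elim (nd other (doubleDominating-mono G ∪⊆other (union-doubleDominating y≢other)))
    where
    other : Fin (suc (suc m))
    other = punchIn y zero

    y≢other : y ≢ other
    y≢other = punchInᵢ≢i y zero ∘ sym

    ∪⊆other : classOf f y ∪ classOf f other ⊆ classOf f other
    ∪⊆other x∈ with x∈p∪q⁻ _ _ x∈
    ... | inj₁ x∈y     = contradiction (_ , ∈-classOf⁻ x∈y) ∄x
    ... | inj₂ x∈other = x∈other

  fewest-dcPartition : IsDCPartition G f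
  fewest-dcPartition = fewest-surjective , λ i →
    let j≢i = punchInᵢ≢i i zero in
    nd i , punchIn i zero , j≢i , nd i , nd _ , union-doubleDominating (j≢i ∘ sym)

module _ (G : Graph n) where

  dcPartition-cong : {f g : Fin n → Fin k} → f ≗ g → IsDCPartition G f → IsDCPartition G g
  dcPartition-cong {f = f} {g} f≗g (surj , coalition) =
    (λ y → let (x , fx≡y) = surj y in x , λ {z} z≡x → trans (sym (f≗g z)) (fx≡y z≡x)) ,
    λ i → let (¬ddᵢ , j , j≢i , coal) = coalition i in
      subst ¬DD (same i) ¬ddᵢ , j , j≢i , subst₂ (IsDoubleCoalition G) (same i) (same j) coal
    where
    ¬DD : Subset n → Set
    ¬DD D = ¬ IsDoubleDominating G D

    same : ∀ i → classOf f i ≡ classOf g i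
    same = classOf-cong f≗g

  hasDCPartitionOfSize? : Decidable (HasDCPartitionOfSize G)
  hasDCPartitionOfSize? k = any-function? n dcPartition-cong λ f →
    surjective? f ×-dec all? λ i →
      ¬DD? (classOf f i) ×-dec any? λ j →
        ¬? (j ≟ i) ×-dec ¬DD? (classOf f i) ×-dec ¬DD? (classOf f j) ×-dec
        doubleDominating? G (classOf f i ∪ classOf f j)
    where
    ¬DD? : (D : Subset n) → Dec (¬ IsDoubleDominating G D)
    ¬DD? D = ¬? (doubleDominating? G D)

  dcPartition-size≤ : ∀ {k} → HasDCPartitionOfSize G k → k ≤ n
  dcPartition-size≤ (_ , surj , _) = surjective⇒≤ surj

mainTheorem3 : (n : ℕ) → 1 ≤ n → (G : Graph n) → MinDegreeAtLeast1 G →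
    Σ ℕ (λ d → IsDCNumber G d × 2 ≤ d × d ≤ n)
mainTheorem3 (suc n) _ G δ
  with least (hasNonDominatingColouring? G) (id , id-nonDominating G)
... | k , (f , nd) , fewest with nonDominating⇒2≤ G zero δ f nd
... | 2≤k@(s≤s (s≤s _)) =   -- the match exposes k as 2 + m
  let dc = f , fewest-dcPartition {G = G} nd fewest
      (d , dc-number) = greatest (hasDCPartitionOfSize? G) (suc n) (dcPartition-size≤ G) dc
      (d-dc , maximum) = dc-number
  in d , dc-number , ≤-trans 2≤k (maximum k dc) , dcPartition-size≤ G d-dc
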